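{- Let $\Delta$ be a C-Log theory and suppose $C$ is an occurrence in $\Delta$ of an expression $\mathbf{All}\,\bar x[\varphi]: (C_1\ \mathbf{And}\ C_2)$. Let $\Delta'$ be obtained from $\Delta$ by replacing this occurrence with $(\mathbf{All}\,\bar x[\varphi]: C_1)\ \mathbf{And}\ (\mathbf{All}\,\bar x[\varphi]: C_2)$. Then $\Delta$ and $\Delta'$ are equivalent (have the same models).
   Context: Fix a relational vocabulary $\Sigma$. Causal effect expressions (CEEs) are defined inductively: every atom $P(\bar t)$ is a CEE; if $\varphi$ is an FO formula and $C'$ a CEE then $C' \leftarrow \varphi$ is a CEE; if $C_1,C_2$ are CEEs then $C_1\ \mathbf{And}\ C_2$ and $C_1\ \mathbf{Or}\ C_2$ are CEEs; if $x$ is a variable, $\varphi$ an FO formula and $C'$ a CEE then $\mathbf{All}\,x[\varphi]: C'$ and $\mathbf{Select}\,x[\varphi]: C'$ are CEEs; $\mathbf{New}\,x: C'$ is a CEE. Endogenous predicates are those occurring in atom-expressions; other symbols are exogenous. A C-Log theory is a CEE without free variables. Variable context of an occurrence: the sequence of variables quantified on the path from the root of the parse tree; $n_C$ its length. $\mathbf{All}\,\bar x[\varphi]:C'$ with $\bar x=(x_1,\dots,x_n)$ abbreviates $\mathbf{All}\,x_1[\mathbf t]:\dots\mathbf{All}\,x_n[\varphi]:C'$, and for $n=0$ abbreviates $C'\leftarrow\varphi$. Semantics: with three truth values ($\mathbf f<\mathbf u<\mathbf t$), partial sets and partial structures evaluated by Kleene logic, a selection function $\zeta$ in a set $D$ gives,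 for each occurrence of a $\mathbf{Select}$-expression $C$, a total function $D^{n_C}\to D$, for each $\mathbf{Or}$-expression a total function $D^{n_C}\to\{1,2\}$, and for each $\mathbf{New}$-expression an injective partial function $D^{n_C}\to D$ with pairwise disjoint images; $\zeta^{in}$ is $D$ minus these images. The effect set of an occurrence (a partial set of domain atoms, using an extra unary predicate $\mathcal U$) is defined recursively: atoms give themselves; $\mathbf{And}$ union; $C'\leftarrow\varphi$ restricts (pointwise min) the effect of $C'$ to $\varphi^I$; $\mathbf{All}\,x[\varphi]:C'$ is the union over $d$ of the effect of $C'$ in $I[x:d]$ restricted to $\min(\mathrm{dom}^I(d),\varphi^{I[x:d]})$; $\mathbf{Or}$ takes the branch chosen by $\zeta$; $\mathbf{Select}$ uses the element $e$ chosen by $\zeta$ and restricts the effect of $C'$ in $I[x:e]$ to $\min(\mathrm{dom}^I(e),\varphi^{I[x:e]})$; $\mathbf{New}$ gives $\emptyset$ if $\zeta$'s function is undefined, else $\{\mathcal U(e)\}$ plus the effect of $C'$ in $I[x:e]$. $\Delta$ succeeds with $\zeta$ in $I$ if every relevant $\mathbf{Select}$-instance's chosen element satisfies its qualification and every relevant $\mathbf{New}$-function is defined. The partial immediate causality operator $A_\zeta$ (on partial structures with domain between $\zeta^{in}$ and $\mathrm{dom}(\mathcal I)$ agreeing with $\mathcal I$ on exogenous symbols) maps $I$ to $I'$ with domain value $\mathbf t$ on $\zeta^{in}$ and the effect-set value of $\mathcal U(d)$ elsewhere, and endogenous atoms getting their effect-set values. A structure $\mathcal I$ is a model of $\Delta$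 if for some $\zeta$, $(\mathcal I,\mathcal I)$ is the well-founded fixpoint of $A_\zeta$ and $\Delta$ succeeds with $\zeta$ in $\mathcal I$. -}

module Defs where

open import Data.Nat using (ℕ; zero; suc)
open import Data.Nat.Properties using () renaming (_≟_ to _≟ℕ_)
open import Data.List using (List; []; _∷_)
open import Data.Vec using (Vec; []; _∷_; _∷ʳ_)
open import Data.Vec.Membership.Propositional using (_∈_)
open import Data.Maybe using (Maybe; just; nothing; maybe′; _>>=_)
import Data.Maybe as Maybe
open import Data.Product using (Σ; _×_; _,_)
open import Data.Sum using (_⊎_)
open import Data.Empty using (⊥)
open import Data.Unit using (⊤)
open import Relation.Nullary using (¬_; yes; no)
open import Relation.Binary.PropositionalEquality using (_≡_)

Var : Set
Var = ℕ

record Vocabulary : Set₁ where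
  field
    Pred  : Set
    arity : Pred → ℕ

-- Child directions in a parse tree.  For unary constructs the (only)
-- child is 'left'.  For Or, 'left' is branch 1 and 'right' is branch 2.
data Dir : Set where
  left right : Dir

-- An occurrence of a subexpression is identified by its path from the root.
Path : Set
Path = List Dir

module Lang (Voc : Vocabulary) where
  open Vocabulary Voc

  data Formula : Set where
    atom : (P : Pred) → Vec Var (arity P) → Formula
    _≐_  : Var → Var → Formula
    ⊤f ⊥f : Formula
    ¬f_  : Formula → Formula
    _∧f_ _∨f_ _⇒f_ : Formula → Formula → Formula
    ∀f ∃f : Var → Formula → Formula

  data CEE : Set where
    atomC  : (P : Pred) → Vec Var (arity P) → CEE
    _⇐_    : CEE → Formula → CEE
    _And_  : CEE → CEE → CEE
    _Or_   : CEE → CEE → CEE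
    All    : Var → Formula → CEE → CEE
    Select : Var → Formula → CEE → CEE
    New    : Var → CEE → CEE

  -- All x̄[φ]: C  abbreviation  (n = 0 gives  C ← φ)
  AllV : List Var → Formula → CEE → CEE
  AllV [] φ C = C ⇐ φ
  AllV (x ∷ []) φ C = All x φ C
  AllV (x ∷ y ∷ xs) φ C = All x ⊤f (AllV (y ∷ xs) φ C)

  data FreeF (x : Var) : Formula → Set where
    atom  : ∀ {P ts} → x ∈ ts → FreeF x (atom P ts)
    eqˡ   : ∀ {y} → FreeF x (x ≐ y)
    eqʳ   : ∀ {y} → FreeF x (y ≐ x)
    neg   : ∀ {φ} → FreeF x φ → FreeF x (¬f φ)
    andˡ  : ∀ {φ ψ} → FreeF x φ → FreeF x (φ ∧f ψ)
    andʳ  : ∀ {φ ψ} → FreeF x ψ → FreeF x (φ ∧f ψ)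
    orˡ   : ∀ {φ ψ} → FreeF x φ → FreeF x (φ ∨f ψ)
    orʳ   : ∀ {φ ψ} → FreeF x ψ → FreeF x (φ ∨f ψ)
    impˡ  : ∀ {φ ψ} → FreeF x φ → FreeF x (φ ⇒f ψ)
    impʳ  : ∀ {φ ψ} → FreeF x ψ → FreeF x (φ ⇒f ψ)
    all   : ∀ {y φ} → ¬ x ≡ y → FreeF x φ → FreeF x (∀f y φ)
    ex    : ∀ {y φ} → ¬ x ≡ y → FreeF x φ → FreeF x (∃f y φ)

  data FreeC (x : Var) : CEE → Set where
    atom    : ∀ {P ts} → x ∈ ts → FreeC x (atomC P ts)
    ruleC   : ∀ {C φ} → FreeC x C → FreeC x (C ⇐ φ)
    ruleφ   : ∀ {C φ} → FreeF x φ → FreeC x (C ⇐ φ)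
    andˡ    : ∀ {C₁ C₂} → FreeC x C₁ → FreeC x (C₁ And C₂)
    andʳ    : ∀ {C₁ C₂} → FreeC x C₂ → FreeC x (C₁ And C₂)
    orˡ     : ∀ {C₁ C₂} → FreeC x C₁ → FreeC x (C₁ Or C₂)
    orʳ     : ∀ {C₁ C₂} → FreeC x C₂ → FreeC x (C₁ Or C₂)
    allφ    : ∀ {y φ C} → ¬ x ≡ y → FreeF x φ → FreeC x (All y φ C)
    allC    : ∀ {y φ C} → ¬ x ≡ y → FreeC x C → FreeC x (All y φ C)
    selφ    : ∀ {y φ C} → ¬ x ≡ y → FreeF x φ → FreeC x (Select y φ C)
    selC    : ∀ {y φ C} → ¬ x ≡ y → FreeC x C → FreeC x (Select y φ C)
    newC    : ∀ {y C} → ¬ x ≡ y → FreeC x C → FreeC x (New y C)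

  -- A C-Log theory is a CEE without free variables.
  Closed : CEE → Set
  Closed Δ = ∀ x → ¬ FreeC x Δ

  data Endo (P : Pred) : CEE → Set where
    here  : ∀ {ts} → Endo P (atomC P ts)
    rule  : ∀ {C φ} → Endo P C → Endo P (C ⇐ φ)
    andˡ  : ∀ {C₁ C₂} → Endo P C₁ → Endo P (C₁ And C₂)
    andʳ  : ∀ {C₁ C₂} → Endo P C₂ → Endo P (C₁ And C₂)
    orˡ   : ∀ {C₁ C₂} → Endo P C₁ → Endo P (C₁ Or C₂)
    orʳ   : ∀ {C₁ C₂} → Endo P C₂ → Endo P (C₁ Or C₂)
    all   : ∀ {x φ C} → Endo P C → Endo P (All x φ C)
    sel   : ∀ {x φ C} → Endo P C → Endo P (Select x φ C)
    new   : ∀ {x C} → Endo P C → Endo P (New x C)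

  at : CEE → Path → Maybe CEE
  at C [] = just C
  at (C ⇐ φ) (left ∷ p) = at C p
  at (C₁ And C₂) (left ∷ p) = at C₁ p
  at (C₁ And C₂) (right ∷ p) = at C₂ p
  at (C₁ Or C₂) (left ∷ p) = at C₁ p
  at (C₁ Or C₂) (right ∷ p) = at C₂ p
  at (All x φ C) (left ∷ p) = at C p
  at (Select x φ C) (left ∷ p) = at C p
  at (New x C) (left ∷ p) = at C p
  at _ _ = nothing

  replace : CEE → Path → CEE → CEE
  replace C [] C' = C'
  replace (C ⇐ φ) (left ∷ p) C' = replace C p C' ⇐ φ
  replace (C₁ And C₂) (left ∷ p) C' = replace C₁ p C' And C₂
  replace (C₁ And C₂) (right ∷ p) C' = C₁ And replace C₂ p C'
  replace (C₁ Or C₂) (left ∷ p) C' = replace C₁ p C' Or C₂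
  replace (C₁ Or C₂) (right ∷ p) C' = C₁ Or replace C₂ p C'
  replace (All x φ C) (left ∷ p) C' = All x φ (replace C p C')
  replace (Select x φ C) (left ∷ p) C' = Select x φ (replace C p C')
  replace (New x C) (left ∷ p) C' = New x (replace C p C')
  replace C _ C' = C

  module Sem (D : Set) where

    -- variable assignments (partial, so that D may be empty)
    Env : Set
    Env = Var → Maybe D

    ∅ : Env
    ∅ _ = nothing

    _[_↦_] : Env → Var → D → Env
    (e [ x ↦ d ]) y with y ≟ℕ x
    ... | yes _ = just d
    ... | no _ = e y

    evalTs : ∀ {n} → Env → Vec Var n → Maybe (Vec D n)
    evalTs e [] = just []
    evalTs e (t ∷ ts) = e t >>= λ d → Maybe.map (d ∷_) (evalTs e ts)

    -- A two-valued structure over D with a domain predicate (the symbol U).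
    -- A partial (three-valued) structure is represented as a pair (L , U)
    -- of such structures: an atom is t iff it holds in L, f iff it fails in U.
    record Struct : Set₁ where
      field
        dom : D → Set
        rel : (P : Pred) → Vec D (arity P) → Set
    open Struct

    record Interp : Set₁ where
      field
        rel : (P : Pred) → Vec D (arity P) → Set

    Tot : Interp → Struct
    dom (Tot I) _ = ⊤
    rel (Tot I) = Interp.rel I

    _≤s_ : Struct → Struct → Set
    S ≤s S' = (∀ d → dom S d → dom S' d) × (∀ P ds → rel S P ds → rel S' P ds)

    _≈s_ : Struct → Struct → Set
    S ≈s S' = (S ≤s S') × (S' ≤s S)

    -- Kleene evaluation: evalF L U e φ  is "φ is true" in the partial
    -- structure (L,U); "φ is not false" is evalF U L e φ.
    evalF : Struct → Struct → Env → Formula → Set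
    evalF L U e (atom P ts) = Σ (Vec D (arity P)) λ ds → evalTs e ts ≡ just ds × rel L P ds
    evalF L U e (x ≐ y) = Σ D λ d → e x ≡ just d × e y ≡ just d
    evalF L U e ⊤f = ⊤
    evalF L U e ⊥f = ⊥
    evalF L U e (¬f φ) = ¬ evalF U L e φ
    evalF L U e (φ ∧f ψ) = evalF L U e φ × evalF L U e ψ
    evalF L U e (φ ∨f ψ) = evalF L U e φ ⊎ evalF L U e ψ
    evalF L U e (φ ⇒f ψ) = (¬ evalF U L e φ) ⊎ evalF L U e ψ
    evalF L U e (∀f x φ) = ∀ d → (¬ dom U d) ⊎ evalF L U (e [ x ↦ d ]) φ
    evalF L U e (∃f x φ) = Σ D λ d → dom L d × evalF L U (e [ x ↦ d ]) φ

    -- Selection functions, organised along the parse tree: at an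
    -- occurrence with variable context of length n, a Select gets a total
    -- function D^n → D, an Or a function D^n → {1,2}, a New a partial
    -- function D^n ⇀ D.
    Zeta : ℕ → CEE → Set
    Zeta n (atomC P ts) = ⊤
    Zeta n (C ⇐ φ) = Zeta n C
    Zeta n (C₁ And C₂) = Zeta n C₁ × Zeta n C₂
    Zeta n (C₁ Or C₂) = (Vec D n → Dir) × Zeta n C₁ × Zeta n C₂
    Zeta n (All x φ C) = Zeta (suc n) C
    Zeta n (Select x φ C) = (Vec D n → D) × Zeta (suc n) C
    Zeta n (New x C) = (Vec D n → Maybe D) × Zeta (suc n) C

    toVec : (n : ℕ) → List D → Maybe (Vec D n)
    toVec zero [] = just []
    toVec (suc n) (d ∷ ds) = Maybe.map (d ∷_) (toVec n ds)
    toVec _ _ = nothing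

    newAt : ∀ n C → Zeta n C → Path → List D → Maybe D
    newAt n (New x C) (f , z) [] ws = toVec n ws >>= f
    newAt n (New x C) (f , z) (left ∷ p) ws = newAt (suc n) C z p ws
    newAt n (C ⇐ φ) z (left ∷ p) ws = newAt n C z p ws
    newAt n (C₁ And C₂) (z₁ , z₂) (left ∷ p) ws = newAt n C₁ z₁ p ws
    newAt n (C₁ And C₂) (z₁ , z₂) (right ∷ p) ws = newAt n C₂ z₂ p ws
    newAt n (C₁ Or C₂) (f , z₁ , z₂) (left ∷ p) ws = newAt n C₁ z₁ p ws
    newAt n (C₁ Or C₂) (f , z₁ , z₂) (right ∷ p) ws = newAt n C₂ z₂ p ws
    newAt n (All x φ C) z (left ∷ p) ws = newAt (suc n) C z p ws
    newAt n (Select x φ C) (f , z) (left ∷ p) ws = newAt (suc n) C z p ws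
    newAt _ _ _ _ _ = nothing

    ValidZeta : (Δ : CEE) → Zeta 0 Δ → Set
    ValidZeta Δ z = ∀ p q ws ws' d → newAt 0 Δ z p ws ≡ just d → newAt 0 Δ z q ws' ≡ just d →
                    (p ≡ q) × (ws ≡ ws')

    ζin : (Δ : CEE) → Zeta 0 Δ → D → Set
    ζin Δ z d = ¬ (Σ Path λ p → Σ (List D) λ ws → newAt 0 Δ z p ws ≡ just d)

    data DAtom : Set where
      uA : D → DAtom
      pA : (P : Pred) → Vec D (arity P) → DAtom

    branch : Dir → Set → Set → Set
    branch left A B = A
    branch right A B = B

    -- effect set (partial set of domain atoms): eff L U … a is "a is t in
    -- the effect set" for the partial structure (L,U); swapping L and U
    -- gives "a is not f".
    eff : Struct → Struct → ∀ n C → Zeta n C → Vec D n → Env → DAtom → Set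
    eff L U n (atomC P ts) z vs e a =
      Σ (Vec D (arity P)) λ ds → evalTs e ts ≡ just ds × a ≡ pA P ds
    eff L U n (C ⇐ φ) z vs e a = eff L U n C z vs e a × evalF L U e φ
    eff L U n (C₁ And C₂) (z₁ , z₂) vs e a = eff L U n C₁ z₁ vs e a ⊎ eff L U n C₂ z₂ vs e a
    eff L U n (C₁ Or C₂) (f , z₁ , z₂) vs e a =
      branch (f vs) (eff L U n C₁ z₁ vs e a) (eff L U n C₂ z₂ vs e a)
    eff L U n (All x φ C) z vs e a =
      Σ D λ d → (dom L d × evalF L U (e [ x ↦ d ]) φ) ×
                eff L U (suc n) C z (vs ∷ʳ d) (e [ x ↦ d ]) a
    eff L U n (Select x φ C) (f , z) vs e a =
      (dom L (f vs) × evalF L U (e [ x ↦ f vs ]) φ) ×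
      eff L U (suc n) C z (vs ∷ʳ f vs) (e [ x ↦ f vs ]) a
    eff L U n (New x C) (f , z) vs e a =
      maybe′ (λ d → (a ≡ uA d) ⊎ eff L U (suc n) C z (vs ∷ʳ d) (e [ x ↦ d ]) a) ⊥ (f vs)

    Succ : Struct → ∀ n C → Zeta n C → Vec D n → Env → Set
    Succ T n (atomC P ts) z vs e = ⊤
    Succ T n (C ⇐ φ) z vs e = evalF T T e φ → Succ T n C z vs e
    Succ T n (C₁ And C₂) (z₁ , z₂) vs e = Succ T n C₁ z₁ vs e × Succ T n C₂ z₂ vs e
    Succ T n (C₁ Or C₂) (f , z₁ , z₂) vs e =
      branch (f vs) (Succ T n C₁ z₁ vs e) (Succ T n C₂ z₂ vs e)
    Succ T n (All x φ C) z vs e =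
      ∀ d → dom T d → evalF T T (e [ x ↦ d ]) φ → Succ T (suc n) C z (vs ∷ʳ d) (e [ x ↦ d ])
    Succ T n (Select x φ C) (f , z) vs e =
      dom T (f vs) × evalF T T (e [ x ↦ f vs ]) φ ×
      Succ T (suc n) C z (vs ∷ʳ f vs) (e [ x ↦ f vs ])
    Succ T n (New x C) (f , z) vs e =
      maybe′ (λ d → Succ T (suc n) C z (vs ∷ʳ d) (e [ x ↦ d ])) ⊥ (f vs)

    Succeeds : (Δ : CEE) → Zeta 0 Δ → Interp → Set
    Succeeds Δ z I = Succ (Tot I) 0 Δ z [] ∅

    -- The partial immediate causality operator A_ζ, on pairs (L,U):
    -- A_ζ(L,U) = (Op L U , Op U L).
    Op : (Δ : CEE) → Interp → Zeta 0 Δ → Struct → Struct → Struct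
    dom (Op Δ I z L U) d = ζin Δ z d ⊎ ((¬ ζin Δ z d) × eff L U 0 Δ z [] ∅ (uA d))
    rel (Op Δ I z L U) P ds =
      (Endo P Δ × eff L U 0 Δ z [] ∅ (pA P ds)) ⊎ ((¬ Endo P Δ) × Interp.rel I P ds)

    -- admissible components: domain contains ζ^in (and is within dom(I) = D),
    -- exogenous symbols agree with I
    Adm : (Δ : CEE) → Interp → Zeta 0 Δ → Struct → Set
    Adm Δ I z S = (∀ d → ζin Δ z d → dom S d) ×
                  (∀ P ds → ¬ Endo P Δ → (rel S P ds → Interp.rel I P ds) × (Interp.rel I P ds → rel S P ds))

    LeastFix : (Struct → Set) → (Struct → Struct) → Struct → Set₁
    LeastFix Q F ℓ = Q ℓ × (F ℓ ≈s ℓ) × (∀ S → Q S → F S ≈s S → ℓ ≤s S)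

    -- Approximation fixpoint theory: stable fixpoints and the well-founded
    -- fixpoint (the ≤p-least fixpoint of the stable operator).
    StableFix : (Δ : CEE) → Interp → Zeta 0 Δ → Struct → Struct → Set₁
    StableFix Δ I z x y =
      LeastFix (λ S → Adm Δ I z S × S ≤s y) (λ S → Op Δ I z S y) x ×
      LeastFix (λ S → Adm Δ I z S × x ≤s S) (λ S → Op Δ I z S x) y

    WFFix : (Δ : CEE) → Interp → Zeta 0 Δ → Struct → Struct → Set₁
    WFFix Δ I z x y = StableFix Δ I z x y ×
      (∀ x' y' → StableFix Δ I z x' y' → (x ≤s x') × (y' ≤s y))

    Model : CEE → Interp → Set₁
    Model Δ I = Σ (Zeta 0 Δ) λ z →
      ValidZeta Δ z × WFFix Δ I z (Tot I) (Tot I) × Succeeds Δ z I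

-- Everything that enters the definition of a model, namely the effect sets,
-- the success condition, the endogenous predicates and the New-instances
-- (which determine ζ^in and the validity of ζ), can be matched between the
-- two sides for corresponding selection functions.  The selection data of
-- All x̄[φ]: (C₁ And C₂) and of (All x̄[φ]: C₁) And (All x̄[φ]: C₂) are the
-- same, the effect sets agree because ∃ and ∧ distribute over ∨, success
-- agrees because ∀ and → distribute over ∧, and the New-instances differ only
-- by a regrouping of paths.  Such a correspondence survives being placed in
-- any context, and models are invariant under it.
module Submission where

open import Defs
open import Data.Nat using (ℕ; suc)
open import Data.List using (List; []; _∷_)
open import Data.Vec using ([]; _∷ʳ_)
open import Data.Maybe using (Maybe; just; nothing; maybe′)
open import Data.Product using (Σ; _×_; _,_; proj₁; proj₂; map₂)
open import Data.Product.Function.NonDependent.Propositional using (_×-⇔_)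
open import Data.Sum using (_⊎_; inj₁; inj₂; [_,_]′)
open import Data.Sum.Function.Propositional using (_⊎-⇔_)
open import Data.Empty using (⊥)
open import Relation.Nullary using (¬_)
open import Relation.Binary.PropositionalEquality using (_≡_; refl; sym; trans; cong; module ≡-Reasoning)
open import Function using (_∘_)
open import Function.Bundles using (_⇔_; mk⇔; Equivalence)
open import Function.Construct.Identity using (⇔-id)
open import Function.Construct.Symmetry using (⇔-sym)
open import Function.Properties.Equivalence using () renaming (trans to ⇔-trans)
open import Function.Properties.Inverse using (↔⇒⇔)
open import Function.Related.TypeIsomorphisms using (×-distribʳ-⊎; →-cong-⇔; ¬-cong-⇔)

open Equivalence using (to; from)

Σ-cong-⇔ : {A : Set} {B C : A → Set} → (∀ x → B x ⇔ C x) → Σ A B ⇔ Σ A C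
Σ-cong-⇔ B⇔C = mk⇔ (map₂ (to (B⇔C _))) (map₂ (from (B⇔C _)))

Π-cong-⇔ : {A : Set} {B C : A → Set} → (∀ x → B x ⇔ C x) → ((x : A) → B x) ⇔ ((x : A) → C x)
Π-cong-⇔ B⇔C = mk⇔ (λ f x → to (B⇔C x) (f x)) (λ g x → from (B⇔C x) (g x))

-- ValidZeta Δ z and ζin Δ z d unfold to InjectiveWhereDefined (newAt 0 Δ z)
-- and ¬ Image (newAt 0 Δ z) d.
NewMap : Set → Set
NewMap D = Path → List D → Maybe D

module _ {D : Set} where

  Image : NewMap D → D → Set
  Image ν d = Σ Path λ p → Σ (List D) λ ws → ν p ws ≡ just d

  InjectiveWhereDefined : NewMap D → Set
  InjectiveWhereDefined ν =
    ∀ p q ws ws′ d → ν p ws ≡ just d → ν q ws′ ≡ just d → (p ≡ q) × (ws ≡ ws′)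

  child : Dir → NewMap D → NewMap D
  child dir ν q = ν (dir ∷ q)

  wrap : NewMap D → NewMap D
  wrap ν []          _ = nothing
  wrap ν (left ∷ q)  = ν q
  wrap ν (right ∷ q) _ = nothing

  join : NewMap D → NewMap D → NewMap D
  join ν₁ ν₂ []          _ = nothing
  join ν₁ ν₂ (left ∷ q)  = ν₁ q
  join ν₁ ν₂ (right ∷ q) = ν₂ q

  -- A bijection between the defined arguments of ν and ν′ preserving values;
  -- the junk values of to-path and from-path, off the defined arguments, are irrelevant.
  record _≅_ (ν ν′ : NewMap D) : Set where
    field
      to-path from-path : Path → Path
      to-agrees   : ∀ q ws → ν q ws ≡ ν′ (to-path q) ws
      from-agrees : ∀ q ws → ν′ q ws ≡ ν (from-path q) ws
      from∘to : ∀ {q ws d} → ν q ws ≡ just d → from-path (to-path q) ≡ q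
      to∘from : ∀ {q ws d} → ν′ q ws ≡ just d → to-path (from-path q) ≡ q
  open _≅_

  ≅-refl : ∀ {ν} → ν ≅ ν
  to-path     ≅-refl q = q
  from-path   ≅-refl q = q
  to-agrees   ≅-refl q ws = refl
  from-agrees ≅-refl q ws = refl
  from∘to     ≅-refl _ = refl
  to∘from     ≅-refl _ = refl

  ≅-sym : ∀ {ν ν′} → ν ≅ ν′ → ν′ ≅ ν
  to-path     (≅-sym i) = from-path i
  from-path   (≅-sym i) = to-path i
  to-agrees   (≅-sym i) = from-agrees i
  from-agrees (≅-sym i) = to-agrees i
  from∘to     (≅-sym i) = to∘from i
  to∘from     (≅-sym i) = from∘to i

  ≅-trans : ∀ {ν₁ ν₂ ν₃} → ν₁ ≅ ν₂ → ν₂ ≅ ν₃ → ν₁ ≅ ν₃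
  to-path     (≅-trans i j) q = to-path j (to-path i q)
  from-path   (≅-trans i j) q = from-path i (from-path j q)
  to-agrees   (≅-trans i j) q ws = trans (to-agrees i q ws) (to-agrees j (to-path i q) ws)
  from-agrees (≅-trans i j) q ws = trans (from-agrees j q ws) (from-agrees i (from-path j q) ws)
  from∘to     (≅-trans i j) {q} {ws} h =
    trans (cong (from-path i) (from∘to j (trans (sym (to-agrees i q ws)) h))) (from∘to i h)
  to∘from     (≅-trans i j) {q} {ws} h =
    trans (cong (to-path j) (to∘from i (trans (sym (from-agrees j q ws)) h))) (to∘from j h)

  ≅-node : ∀ {ν ν′} → (∀ ws → ν [] ws ≡ ν′ [] ws) →
           child left ν ≅ child left ν′ → child right ν ≅ child right ν′ → ν ≅ ν′
  ≅-node {ν} {ν′} root l r = record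
    { to-path = below (to-path l) (to-path r)
    ; from-path = below (from-path l) (from-path r)
    ; to-agrees = to-agrees′
    ; from-agrees = from-agrees′
    ; from∘to = from∘to′
    ; to∘from = to∘from′
    }
    where
    below : (Path → Path) → (Path → Path) → Path → Path
    below f g []          = []
    below f g (left ∷ q)  = left ∷ f q
    below f g (right ∷ q) = right ∷ g q

    to-agrees′ : ∀ q ws → ν q ws ≡ ν′ (below (to-path l) (to-path r) q) ws
    to-agrees′ []          ws = root ws
    to-agrees′ (left ∷ q)  ws = to-agrees l q ws
    to-agrees′ (right ∷ q) ws = to-agrees r q ws

    from-agrees′ : ∀ q ws → ν′ q ws ≡ ν (below (from-path l) (from-path r) q) ws
    from-agrees′ []          ws = sym (root ws)
    from-agrees′ (left ∷ q)  ws = from-agrees l q ws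
    from-agrees′ (right ∷ q) ws = from-agrees r q ws

    from∘to′ : ∀ {q ws d} → ν q ws ≡ just d →
               below (from-path l) (from-path r) (below (to-path l) (to-path r) q) ≡ q
    from∘to′ {[]}        _ = refl
    from∘to′ {left ∷ q}  h = cong (left ∷_) (from∘to l h)
    from∘to′ {right ∷ q} h = cong (right ∷_) (from∘to r h)

    to∘from′ : ∀ {q ws d} → ν′ q ws ≡ just d →
               below (to-path l) (to-path r) (below (from-path l) (from-path r) q) ≡ q
    to∘from′ {[]}        _ = refl
    to∘from′ {left ∷ q}  h = cong (left ∷_) (to∘from l h)
    to∘from′ {right ∷ q} h = cong (right ∷_) (to∘from r h)

  wrap-join-≅ : ∀ {ν₁ ν₂} → wrap (join ν₁ ν₂) ≅ join (wrap ν₁) (wrap ν₂)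
  wrap-join-≅ {ν₁} {ν₂} = record
    { to-path = regroup
    ; from-path = ungroup
    ; to-agrees = to-agrees′
    ; from-agrees = from-agrees′
    ; from∘to = from∘to′
    ; to∘from = to∘from′
    }
    where
    regroup ungroup : Path → Path
    regroup (left ∷ left ∷ q)  = left ∷ left ∷ q
    regroup (left ∷ right ∷ q) = right ∷ left ∷ q
    regroup _                  = []
    ungroup (left ∷ left ∷ q)  = left ∷ left ∷ q
    ungroup (right ∷ left ∷ q) = left ∷ right ∷ q
    ungroup _                  = []

    to-agrees′ : ∀ q ws → wrap (join ν₁ ν₂) q ws ≡ join (wrap ν₁) (wrap ν₂) (regroup q) ws
    to-agrees′ []                 _ = refl
    to-agrees′ (left ∷ [])        _ = refl
    to-agrees′ (left ∷ left ∷ q)  _ = refl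
    to-agrees′ (left ∷ right ∷ q) _ = refl
    to-agrees′ (right ∷ q)        _ = refl

    from-agrees′ : ∀ q ws → join (wrap ν₁) (wrap ν₂) q ws ≡ wrap (join ν₁ ν₂) (ungroup q) ws
    from-agrees′ []                  _ = refl
    from-agrees′ (left ∷ [])         _ = refl
    from-agrees′ (left ∷ left ∷ q)   _ = refl
    from-agrees′ (left ∷ right ∷ q)  _ = refl
    from-agrees′ (right ∷ [])        _ = refl
    from-agrees′ (right ∷ left ∷ q)  _ = refl
    from-agrees′ (right ∷ right ∷ q) _ = refl

    from∘to′ : ∀ {q ws d} → wrap (join ν₁ ν₂) q ws ≡ just d → ungroup (regroup q) ≡ q
    from∘to′ {[]}                 ()
    from∘to′ {left ∷ []}          ()
    from∘to′ {left ∷ left ∷ q}    _ = refl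
    from∘to′ {left ∷ right ∷ q}   _ = refl
    from∘to′ {right ∷ q}          ()

    to∘from′ : ∀ {q ws d} → join (wrap ν₁) (wrap ν₂) q ws ≡ just d → regroup (ungroup q) ≡ q
    to∘from′ {[]}                  ()
    to∘from′ {left ∷ []}           ()
    to∘from′ {left ∷ left ∷ q}     _ = refl
    to∘from′ {left ∷ right ∷ q}    ()
    to∘from′ {right ∷ []}          ()
    to∘from′ {right ∷ left ∷ q}    _ = refl
    to∘from′ {right ∷ right ∷ q}   ()

  ≅-Image : ∀ {ν ν′} → ν ≅ ν′ → ∀ d → Image ν d ⇔ Image ν′ d
  ≅-Image i d = mk⇔
    (λ (q , ws , h) → to-path i q , ws , trans (sym (to-agrees i q ws)) h)
    (λ (q , ws , h) → from-path i q , ws , trans (sym (from-agrees i q ws)) h)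

  ≅-InjectiveWhereDefined : ∀ {ν ν′} → ν ≅ ν′ → InjectiveWhereDefined ν → InjectiveWhereDefined ν′
  ≅-InjectiveWhereDefined i inj q q′ ws ws′ d h h′
    with inj (from-path i q) (from-path i q′) ws ws′ d
             (trans (sym (from-agrees i q ws)) h) (trans (sym (from-agrees i q′ ws′)) h′)
  ... | from-q≡from-q′ , refl = q≡q′ , refl
    where
    open ≡-Reasoning
    q≡q′ : q ≡ q′
    q≡q′ = begin
      q                          ≡⟨ sym (to∘from i h) ⟩
      to-path i (from-path i q)  ≡⟨ cong (to-path i) from-q≡from-q′ ⟩
      to-path i (from-path i q′) ≡⟨ to∘from i h′ ⟩
      q′                         ∎

module Interchange (Voc : Vocabulary) (D : Set) where
  open Lang Voc
  open Sem D

  branch-cong : ∀ dir {A A′ B B′} → A ⇔ A′ → B ⇔ B′ → branch dir A B ⇔ branch dir A′ B′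
  branch-cong left  A⇔A′ _ = A⇔A′
  branch-cong right _ B⇔B′ = B⇔B′

  maybe′-cong : ∀ (m : Maybe D) {P Q : D → Set} → (∀ d → P d ⇔ Q d) → maybe′ P ⊥ m ⇔ maybe′ Q ⊥ m
  maybe′-cong (just d) P⇔Q = P⇔Q d
  maybe′-cong nothing  _   = ⇔-id ⊥

  record Interchangeable (n : ℕ) (C C′ : CEE) : Set₁ where
    field
      Matches : Zeta n C → Zeta n C′ → Set
      match   : ∀ z → Σ (Zeta n C′) (Matches z)
      match⁻  : ∀ z′ → Σ (Zeta n C) (λ z → Matches z z′)
      eff-⇔   : ∀ {z z′} → Matches z z′ → ∀ L U vs e a →
                eff L U n C z vs e a ⇔ eff L U n C′ z′ vs e a
      Succ-⇔  : ∀ {z z′} → Matches z z′ → ∀ T vs e → Succ T n C z vs e ⇔ Succ T n C′ z′ vs e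
      Endo-⇔  : ∀ P → Endo P C ⇔ Endo P C′
      newAt-≅ : ∀ {z z′} → Matches z z′ → newAt n C z ≅ newAt n C′ z′
  open Interchangeable

  interchangeable-refl : ∀ {n} C → Interchangeable n C C
  Matches (interchangeable-refl C) = _≡_
  match   (interchangeable-refl C) z = z , refl
  match⁻  (interchangeable-refl C) z = z , refl
  eff-⇔   (interchangeable-refl C) refl L U vs e a = ⇔-id _
  Succ-⇔  (interchangeable-refl C) refl T vs e = ⇔-id _
  Endo-⇔  (interchangeable-refl C) P = ⇔-id _
  newAt-≅ (interchangeable-refl C) refl = ≅-refl

  interchangeable-sym : ∀ {n C C′} → Interchangeable n C C′ → Interchangeable n C′ C
  Matches (interchangeable-sym c) z′ z = Matches c z z′
  match   (interchangeable-sym c) = match⁻ c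
  match⁻  (interchangeable-sym c) = match c
  eff-⇔   (interchangeable-sym c) r L U vs e a = ⇔-sym (eff-⇔ c r L U vs e a)
  Succ-⇔  (interchangeable-sym c) r T vs e = ⇔-sym (Succ-⇔ c r T vs e)
  Endo-⇔  (interchangeable-sym c) P = ⇔-sym (Endo-⇔ c P)
  newAt-≅ (interchangeable-sym c) r = ≅-sym (newAt-≅ c r)

  interchangeable-trans : ∀ {n C C′ C″} →
    Interchangeable n C C′ → Interchangeable n C′ C″ → Interchangeable n C C″
  Matches (interchangeable-trans c d) z z″ = Σ _ λ z′ → Matches c z z′ × Matches d z′ z″
  match   (interchangeable-trans c d) z =
    let (z′ , r) = match c z ; (z″ , s) = match d z′ in z″ , z′ , r , s
  match⁻  (interchangeable-trans c d) z″ =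
    let (z′ , s) = match⁻ d z″ ; (z , r) = match⁻ c z′ in z , z′ , r , s
  eff-⇔   (interchangeable-trans c d) (_ , r , s) L U vs e a =
    ⇔-trans (eff-⇔ c r L U vs e a) (eff-⇔ d s L U vs e a)
  Succ-⇔  (interchangeable-trans c d) (_ , r , s) T vs e =
    ⇔-trans (Succ-⇔ c r T vs e) (Succ-⇔ d s T vs e)
  Endo-⇔  (interchangeable-trans c d) P = ⇔-trans (Endo-⇔ c P) (Endo-⇔ d P)
  newAt-≅ (interchangeable-trans c d) (_ , r , s) = ≅-trans (newAt-≅ c r) (newAt-≅ d s)

  ⇐-cong : ∀ {n C C′} φ → Interchangeable n C C′ → Interchangeable n (C ⇐ φ) (C′ ⇐ φ)
  Matches (⇐-cong φ c) = Matches c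
  match   (⇐-cong φ c) = match c
  match⁻  (⇐-cong φ c) = match⁻ c
  eff-⇔   (⇐-cong φ c) r L U vs e a = eff-⇔ c r L U vs e a ×-⇔ ⇔-id _
  Succ-⇔  (⇐-cong φ c) r T vs e = →-cong-⇔ (⇔-id _) (Succ-⇔ c r T vs e)
  Endo-⇔  (⇐-cong φ c) P =
    mk⇔ (λ { (rule h) → rule (to (Endo-⇔ c P) h) }) (λ { (rule h) → rule (from (Endo-⇔ c P) h) })
  newAt-≅ (⇐-cong φ c) r = ≅-node (λ _ → refl) (newAt-≅ c r) ≅-refl

  And-cong : ∀ {n C₁ C₁′ C₂ C₂′} → Interchangeable n C₁ C₁′ → Interchangeable n C₂ C₂′ →
             Interchangeable n (C₁ And C₂) (C₁′ And C₂′)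
  Matches (And-cong c₁ c₂) (z₁ , z₂) (z₁′ , z₂′) = Matches c₁ z₁ z₁′ × Matches c₂ z₂ z₂′
  match   (And-cong c₁ c₂) (z₁ , z₂) =
    let (z₁′ , r₁) = match c₁ z₁ ; (z₂′ , r₂) = match c₂ z₂ in (z₁′ , z₂′) , r₁ , r₂
  match⁻  (And-cong c₁ c₂) (z₁′ , z₂′) =
    let (z₁ , r₁) = match⁻ c₁ z₁′ ; (z₂ , r₂) = match⁻ c₂ z₂′ in (z₁ , z₂) , r₁ , r₂
  eff-⇔   (And-cong c₁ c₂) (r₁ , r₂) L U vs e a = eff-⇔ c₁ r₁ L U vs e a ⊎-⇔ eff-⇔ c₂ r₂ L U vs e a
  Succ-⇔  (And-cong c₁ c₂) (r₁ , r₂) T vs e = Succ-⇔ c₁ r₁ T vs e ×-⇔ Succ-⇔ c₂ r₂ T vs e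
  Endo-⇔  (And-cong c₁ c₂) P = mk⇔
    (λ { (andˡ h) → andˡ (to (Endo-⇔ c₁ P) h) ; (andʳ h) → andʳ (to (Endo-⇔ c₂ P) h) })
    (λ { (andˡ h) → andˡ (from (Endo-⇔ c₁ P) h) ; (andʳ h) → andʳ (from (Endo-⇔ c₂ P) h) })
  newAt-≅ (And-cong c₁ c₂) (r₁ , r₂) = ≅-node (λ _ → refl) (newAt-≅ c₁ r₁) (newAt-≅ c₂ r₂)

  Or-cong : ∀ {n C₁ C₁′ C₂ C₂′} → Interchangeable n C₁ C₁′ → Interchangeable n C₂ C₂′ →
            Interchangeable n (C₁ Or C₂) (C₁′ Or C₂′)
  Matches (Or-cong c₁ c₂) (f , z₁ , z₂) (f′ , z₁′ , z₂′) =
    f ≡ f′ × Matches c₁ z₁ z₁′ × Matches c₂ z₂ z₂′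
  match   (Or-cong c₁ c₂) (f , z₁ , z₂) =
    let (z₁′ , r₁) = match c₁ z₁ ; (z₂′ , r₂) = match c₂ z₂ in (f , z₁′ , z₂′) , refl , r₁ , r₂
  match⁻  (Or-cong c₁ c₂) (f , z₁′ , z₂′) =
    let (z₁ , r₁) = match⁻ c₁ z₁′ ; (z₂ , r₂) = match⁻ c₂ z₂′ in (f , z₁ , z₂) , refl , r₁ , r₂
  eff-⇔   (Or-cong c₁ c₂) {f , _} (refl , r₁ , r₂) L U vs e a =
    branch-cong (f vs) (eff-⇔ c₁ r₁ L U vs e a) (eff-⇔ c₂ r₂ L U vs e a)
  Succ-⇔  (Or-cong c₁ c₂) {f , _} (refl , r₁ , r₂) T vs e =
    branch-cong (f vs) (Succ-⇔ c₁ r₁ T vs e) (Succ-⇔ c₂ r₂ T vs e)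
  Endo-⇔  (Or-cong c₁ c₂) P = mk⇔
    (λ { (orˡ h) → orˡ (to (Endo-⇔ c₁ P) h) ; (orʳ h) → orʳ (to (Endo-⇔ c₂ P) h) })
    (λ { (orˡ h) → orˡ (from (Endo-⇔ c₁ P) h) ; (orʳ h) → orʳ (from (Endo-⇔ c₂ P) h) })
  newAt-≅ (Or-cong c₁ c₂) (refl , r₁ , r₂) = ≅-node (λ _ → refl) (newAt-≅ c₁ r₁) (newAt-≅ c₂ r₂)

  All-cong : ∀ {n C C′} x φ → Interchangeable (suc n) C C′ → Interchangeable n (All x φ C) (All x φ C′)
  Matches (All-cong x φ c) = Matches c
  match   (All-cong x φ c) = match c
  match⁻  (All-cong x φ c) = match⁻ c
  eff-⇔   (All-cong x φ c) r L U vs e a =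
    Σ-cong-⇔ λ d → ⇔-id _ ×-⇔ eff-⇔ c r L U (vs ∷ʳ d) (e [ x ↦ d ]) a
  Succ-⇔  (All-cong x φ c) r T vs e =
    Π-cong-⇔ λ d → Π-cong-⇔ λ _ → Π-cong-⇔ λ _ → Succ-⇔ c r T (vs ∷ʳ d) (e [ x ↦ d ])
  Endo-⇔  (All-cong x φ c) P =
    mk⇔ (λ { (all h) → all (to (Endo-⇔ c P) h) }) (λ { (all h) → all (from (Endo-⇔ c P) h) })
  newAt-≅ (All-cong x φ c) r = ≅-node (λ _ → refl) (newAt-≅ c r) ≅-refl

  Select-cong : ∀ {n C C′} x φ → Interchangeable (suc n) C C′ →
                Interchangeable n (Select x φ C) (Select x φ C′)
  Matches (Select-cong x φ c) (f , z) (f′ , z′) = f ≡ f′ × Matches c z z′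
  match   (Select-cong x φ c) (f , z) = let (z′ , r) = match c z in (f , z′) , refl , r
  match⁻  (Select-cong x φ c) (f , z′) = let (z , r) = match⁻ c z′ in (f , z) , refl , r
  eff-⇔   (Select-cong x φ c) {f , _} (refl , r) L U vs e a =
    ⇔-id _ ×-⇔ eff-⇔ c r L U (vs ∷ʳ f vs) (e [ x ↦ f vs ]) a
  Succ-⇔  (Select-cong x φ c) {f , _} (refl , r) T vs e =
    ⇔-id _ ×-⇔ ⇔-id _ ×-⇔ Succ-⇔ c r T (vs ∷ʳ f vs) (e [ x ↦ f vs ])
  Endo-⇔  (Select-cong x φ c) P =
    mk⇔ (λ { (sel h) → sel (to (Endo-⇔ c P) h) }) (λ { (sel h) → sel (from (Endo-⇔ c P) h) })
  newAt-≅ (Select-cong x φ c) (refl , r) = ≅-node (λ _ → refl) (newAt-≅ c r) ≅-refl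

  New-cong : ∀ {n C C′} x → Interchangeable (suc n) C C′ → Interchangeable n (New x C) (New x C′)
  Matches (New-cong x c) (f , z) (f′ , z′) = f ≡ f′ × Matches c z z′
  match   (New-cong x c) (f , z) = let (z′ , r) = match c z in (f , z′) , refl , r
  match⁻  (New-cong x c) (f , z′) = let (z , r) = match⁻ c z′ in (f , z) , refl , r
  eff-⇔   (New-cong x c) {f , _} (refl , r) L U vs e a =
    maybe′-cong (f vs) λ d → ⇔-id _ ⊎-⇔ eff-⇔ c r L U (vs ∷ʳ d) (e [ x ↦ d ]) a
  Succ-⇔  (New-cong x c) {f , _} (refl , r) T vs e =
    maybe′-cong (f vs) λ d → Succ-⇔ c r T (vs ∷ʳ d) (e [ x ↦ d ])
  Endo-⇔  (New-cong x c) P =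
    mk⇔ (λ { (new h) → new (to (Endo-⇔ c P) h) }) (λ { (new h) → new (from (Endo-⇔ c P) h) })
  newAt-≅ (New-cong x c) (refl , r) = ≅-node (λ _ → refl) (newAt-≅ c r) ≅-refl

  replace-cong : ∀ n Δ p {X Y} → at Δ p ≡ just X → (∀ m → Interchangeable m X Y) →
                 Interchangeable n Δ (replace Δ p Y)
  replace-cong n Δ              []          refl X≋Y = X≋Y n
  replace-cong n (C ⇐ φ)        (left ∷ p)  h X≋Y = ⇐-cong φ (replace-cong n C p h X≋Y)
  replace-cong n (C₁ And C₂)    (left ∷ p)  h X≋Y =
    And-cong (replace-cong n C₁ p h X≋Y) (interchangeable-refl C₂)
  replace-cong n (C₁ And C₂)    (right ∷ p) h X≋Y =
    And-cong (interchangeable-refl C₁) (replace-cong n C₂ p h X≋Y)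
  replace-cong n (C₁ Or C₂)     (left ∷ p)  h X≋Y =
    Or-cong (replace-cong n C₁ p h X≋Y) (interchangeable-refl C₂)
  replace-cong n (C₁ Or C₂)     (right ∷ p) h X≋Y =
    Or-cong (interchangeable-refl C₁) (replace-cong n C₂ p h X≋Y)
  replace-cong n (All x φ C)    (left ∷ p)  h X≋Y = All-cong x φ (replace-cong (suc n) C p h X≋Y)
  replace-cong n (Select x φ C) (left ∷ p)  h X≋Y = Select-cong x φ (replace-cong (suc n) C p h X≋Y)
  replace-cong n (New x C)      (left ∷ p)  h X≋Y = New-cong x (replace-cong (suc n) C p h X≋Y)
  replace-cong n (atomC P ts)   (_ ∷ p)     () _
  replace-cong n (C ⇐ φ)        (right ∷ p) () _
  replace-cong n (All x φ C)    (right ∷ p) () _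
  replace-cong n (Select x φ C) (right ∷ p) () _
  replace-cong n (New x C)      (right ∷ p) () _

  ⇐-distrib-And : ∀ {n} φ C₁ C₂ → Interchangeable n ((C₁ And C₂) ⇐ φ) ((C₁ ⇐ φ) And (C₂ ⇐ φ))
  Matches (⇐-distrib-And φ C₁ C₂) = _≡_
  match   (⇐-distrib-And φ C₁ C₂) z = z , refl
  match⁻  (⇐-distrib-And φ C₁ C₂) z = z , refl
  eff-⇔   (⇐-distrib-And φ C₁ C₂) refl L U vs e a = ↔⇒⇔ ×-distribʳ-⊎
  Succ-⇔  (⇐-distrib-And φ C₁ C₂) refl T vs e =
    mk⇔ (λ h → proj₁ ∘ h , proj₂ ∘ h) (λ (h₁ , h₂) ev → h₁ ev , h₂ ev)
  Endo-⇔  (⇐-distrib-And φ C₁ C₂) P = mk⇔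
    (λ { (rule (andˡ h)) → andˡ (rule h) ; (rule (andʳ h)) → andʳ (rule h) })
    (λ { (andˡ (rule h)) → rule (andˡ h) ; (andʳ (rule h)) → rule (andʳ h) })
  -- Unfolded, the two New-maps are wrap (join ν₁ ν₂) and join (wrap ν₁) (wrap ν₂).
  newAt-≅ (⇐-distrib-And φ C₁ C₂) refl =
    ≅-trans (≅-node (λ _ → refl) (≅-node (λ _ → refl) ≅-refl ≅-refl) ≅-refl)
            (≅-trans wrap-join-≅
                     (≅-node (λ _ → refl) (≅-node (λ _ → refl) ≅-refl ≅-refl)
                                          (≅-node (λ _ → refl) ≅-refl ≅-refl)))

  All-distrib-And : ∀ {n} x φ C₁ C₂ →
    Interchangeable n (All x φ (C₁ And C₂)) (All x φ C₁ And All x φ C₂)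
  Matches (All-distrib-And x φ C₁ C₂) = _≡_
  match   (All-distrib-And x φ C₁ C₂) z = z , refl
  match⁻  (All-distrib-And x φ C₁ C₂) z = z , refl
  eff-⇔   (All-distrib-And x φ C₁ C₂) refl L U vs e a = mk⇔
    (λ { (d , h , inj₁ y) → inj₁ (d , h , y) ; (d , h , inj₂ y) → inj₂ (d , h , y) })
    [ map₂ (map₂ inj₁) , map₂ (map₂ inj₂) ]′
  Succ-⇔  (All-distrib-And x φ C₁ C₂) refl T vs e = mk⇔
    (λ h → (λ d dm ev → proj₁ (h d dm ev)) , (λ d dm ev → proj₂ (h d dm ev)))
    (λ (h₁ , h₂) d dm ev → h₁ d dm ev , h₂ d dm ev)
  Endo-⇔  (All-distrib-And x φ C₁ C₂) P = mk⇔
    (λ { (all (andˡ h)) → andˡ (all h) ; (all (andʳ h)) → andʳ (all h) })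
    (λ { (andˡ (all h)) → all (andˡ h) ; (andʳ (all h)) → all (andʳ h) })
  newAt-≅ (All-distrib-And x φ C₁ C₂) refl =
    ≅-trans (≅-node (λ _ → refl) (≅-node (λ _ → refl) ≅-refl ≅-refl) ≅-refl)
            (≅-trans wrap-join-≅
                     (≅-node (λ _ → refl) (≅-node (λ _ → refl) ≅-refl ≅-refl)
                                          (≅-node (λ _ → refl) ≅-refl ≅-refl)))

  AllV-distrib-And : ∀ {n} xs φ C₁ C₂ →
    Interchangeable n (AllV xs φ (C₁ And C₂)) (AllV xs φ C₁ And AllV xs φ C₂)
  AllV-distrib-And []          φ C₁ C₂ = ⇐-distrib-And φ C₁ C₂
  AllV-distrib-And (x ∷ [])     φ C₁ C₂ = All-distrib-And x φ C₁ C₂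
  AllV-distrib-And (x ∷ y ∷ xs) φ C₁ C₂ =
    interchangeable-trans (All-cong x ⊤f (AllV-distrib-And (y ∷ xs) φ C₁ C₂))
                          (All-distrib-And x ⊤f (AllV (y ∷ xs) φ C₁) (AllV (y ∷ xs) φ C₂))

  ≤s-trans : ∀ {S₁ S₂ S₃} → S₁ ≤s S₂ → S₂ ≤s S₃ → S₁ ≤s S₃
  ≤s-trans (dom₁₂ , rel₁₂) (dom₂₃ , rel₂₃) =
    (λ d h → dom₂₃ d (dom₁₂ d h)) , (λ P ds h → rel₂₃ P ds (rel₁₂ P ds h))

  ≈s-trans : ∀ {S₁ S₂ S₃} → S₁ ≈s S₂ → S₂ ≈s S₃ → S₁ ≈s S₃
  ≈s-trans (≤₁₂ , ≥₁₂) (≤₂₃ , ≥₂₃) = ≤s-trans ≤₁₂ ≤₂₃ , ≤s-trans ≥₂₃ ≥₁₂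

  ≈s-sym : ∀ {S₁ S₂} → S₁ ≈s S₂ → S₂ ≈s S₁
  ≈s-sym (≤₁₂ , ≥₁₂) = ≥₁₂ , ≤₁₂

  ⇔⇒≈s : ∀ {S S′} → (∀ d → Struct.dom S d ⇔ Struct.dom S′ d) →
         (∀ P ds → Struct.rel S P ds ⇔ Struct.rel S′ P ds) → S ≈s S′
  ⇔⇒≈s dom⇔ rel⇔ = ((λ d → to (dom⇔ d)) , (λ P ds → to (rel⇔ P ds)))
                 , ((λ d → from (dom⇔ d)) , (λ P ds → from (rel⇔ P ds)))

  LeastFix-cong : ∀ {Q Q′ : Struct → Set} {F F′ : Struct → Struct} {ℓ} →
    (∀ S → Q S ⇔ Q′ S) → (∀ S → F S ≈s F′ S) → LeastFix Q F ℓ → LeastFix Q′ F′ ℓ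
  LeastFix-cong {ℓ = ℓ} Q⇔Q′ F≈F′ (qℓ , fixed , least) =
      to (Q⇔Q′ ℓ) qℓ
    , ≈s-trans (≈s-sym (F≈F′ ℓ)) fixed
    , λ S q′S fixed′ → least S (from (Q⇔Q′ S) q′S) (≈s-trans (F≈F′ S) fixed′)

  module _ {Δ Δ′} (c : Interchangeable 0 Δ Δ′) (I : Interp) {z z′} (r : Matches c z z′) where

    ζin-⇔ : ∀ d → ζin Δ z d ⇔ ζin Δ′ z′ d
    ζin-⇔ d = ¬-cong-⇔ (≅-Image (newAt-≅ c r) d)

    Op-≈s : ∀ L U → Op Δ I z L U ≈s Op Δ′ I z′ L U
    Op-≈s L U = ⇔⇒≈s
      (λ d → ζin-⇔ d ⊎-⇔ (¬-cong-⇔ (ζin-⇔ d) ×-⇔ eff-⇔ c r L U [] ∅ (uA d)))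
      (λ P ds → (Endo-⇔ c P ×-⇔ eff-⇔ c r L U [] ∅ (pA P ds)) ⊎-⇔ (¬-cong-⇔ (Endo-⇔ c P) ×-⇔ ⇔-id _))

    Adm-⇔ : ∀ S → Adm Δ I z S ⇔ Adm Δ′ I z′ S
    Adm-⇔ S = (Π-cong-⇔ λ d → →-cong-⇔ (ζin-⇔ d) (⇔-id _))
          ×-⇔ (Π-cong-⇔ λ P → Π-cong-⇔ λ _ → →-cong-⇔ (¬-cong-⇔ (Endo-⇔ c P)) (⇔-id _))

    StableFix-transfer : ∀ x y → StableFix Δ I z x y → StableFix Δ′ I z′ x y
    StableFix-transfer x y (least-x , least-y) =
        LeastFix-cong (λ S → Adm-⇔ S ×-⇔ ⇔-id _) (λ S → Op-≈s S y) least-x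
      , LeastFix-cong (λ S → Adm-⇔ S ×-⇔ ⇔-id _) (λ S → Op-≈s S x) least-y

  WFFix-transfer : ∀ {Δ Δ′} (c : Interchangeable 0 Δ Δ′) (I : Interp) {z z′} (r : Matches c z z′) →
                   ∀ x y → WFFix Δ I z x y → WFFix Δ′ I z′ x y
  WFFix-transfer c I r x y (stable , most-precise) =
      StableFix-transfer c I r x y stable
    , λ x′ y′ stable′ → most-precise x′ y′ (StableFix-transfer (interchangeable-sym c) I r x′ y′ stable′)

  Model-transfer : ∀ {Δ Δ′} → Interchangeable 0 Δ Δ′ → ∀ I → Model Δ I → Model Δ′ I
  Model-transfer c I (z , valid , wf , succeeds) =
    let (z′ , r) = match c z in
      z′
    , ≅-InjectiveWhereDefined (newAt-≅ c r) valid
    , WFFix-transfer c I r (Tot I) (Tot I) wf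
    , to (Succ-⇔ c r (Tot I) [] ∅) succeeds

lemma1 : (Voc : Vocabulary) → let open Lang Voc in
    (Δ : CEE) → Closed Δ →
    (p : Path) (xs : List Var) (φ : Formula) (C₁ C₂ : CEE) →
    at Δ p ≡ just (AllV xs φ (C₁ And C₂)) →
    (D : Set) (I : Sem.Interp D) →
    Sem.Model D Δ I ⇔ Sem.Model D (replace Δ p (AllV xs φ C₁ And AllV xs φ C₂)) I
lemma1 Voc Δ _ p xs φ C₁ C₂ at-p D I =
  mk⇔ (Model-transfer Δ≋Δ′ I) (Model-transfer (interchangeable-sym Δ≋Δ′) I)
  where
  open Lang Voc
  open Interchange Voc D
  Δ≋Δ′ : Interchangeable 0 Δ (replace Δ p (AllV xs φ C₁ And AllV xs φ C₂))
  Δ≋Δ′ = replace-cong 0 Δ p at-p (λ _ → AllV-distrib-And xs φ C₁ C₂)
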